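{- Let $k\geq 3$, $r\geq 0$ and $n=3^k-1+2r$. The $\{2k,2k\}$-equivelar polyhedral map $D_{\{2k,2k\}}(n)$ is orientable if $r$ is even and non-orientable if $r$ is odd.
   Context: Vertices are elements of $\mathbb{Z}_n$. Given a sequence of integers $\delta_1,\dots,\delta_m$ with $\sum\delta_j\equiv 2\pmod n$, put $w_0=0$, $w_j=w_{j-1}+\delta_j$ (mod $n$); the associated cyclic map is the cell decomposition of a surface whose $2$-cells are all $\mathbb{Z}_n$-translates of the polygon with cyclic vertex sequence $(0,1,2,w_{m-1},w_{m-2},\dots,w_1)$, glued along common edges. $D_{\{2k,2k\}}(n)$ is the map associated with the sequence $-(3^{k-1}+r),\;-(3^{k-1}+r),\;-3^{k-2},-3^{k-2},\dots,-9,-9,-3,-3$ (the pairs $-3^i,-3^i$ for $i=k-2,\dots,1$). It is a polyhedral map on a closed surface in which all faces are $2k$-gons and all vertices have degree $2k$. Orientability refers to the underlying surface. -}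

module Defs where

open import Data.Nat as ℕ using (ℕ; zero; suc; _∸_)
open import Data.Integer using (ℤ; +_; -_; _+_; _-_)
open import Data.Integer.Divisibility using (_∣_)
open import Data.List using (List; []; _∷_; _++_; [_]; reverse; zip; length; lookup; map)
open import Data.Fin using (Fin; toℕ)
open import Data.Bool using (Bool; true; false)
open import Data.Product using (_×_; _,_; ∃; proj₁; proj₂)
open import Relation.Binary.PropositionalEquality using (_≡_)

_≡[mod_]_ : ℤ → ℕ → ℤ → Set
a ≡[mod n ] b = (+ n) ∣ (a - b)

-- Partial sums w_1, …, w_{m-1} of δ_1, …, δ_m (the last one, w_m, omitted),
-- starting from the accumulator w_0.
initSums : ℤ → List ℤ → List ℤ
initSums acc []           = []
initSums acc (d ∷ [])     = []
initSums acc (d ∷ e ∷ ds) = (acc + d) ∷ initSums (acc + d) (e ∷ ds)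

-- Base polygon of the cyclic map of δ: cyclic vertex sequence
-- (0, 1, 2, w_{m-1}, w_{m-2}, …, w_1).
basePolygon : List ℤ → List ℤ
basePolygon δ = + 0 ∷ + 1 ∷ + 2 ∷ reverse (initSums (+ 0) δ)

-- The face t of the cyclic map (translate of the base polygon by t ∈ ℤ_n),
-- oriented as the base polygon (true) or reversed (false).
face : List ℤ → ℕ → Bool → List ℤ
face δ t true  = map (λ v → + t + v) (basePolygon δ)
face δ t false = reverse (face δ t true)

rotate : List ℤ → List ℤ
rotate []       = []
rotate (x ∷ xs) = xs ++ [ x ]

dedges : List ℤ → List (ℤ × ℤ)
dedges xs = zip xs (rotate xs)

-- Orientability of the cyclic map associated with δ on ℤ_n: one can choose an
-- orientation of every face (2-cell) so that no directed edge occurs twice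
-- among the oriented faces (i.e. the two faces at each edge induce opposite
-- directions on it).
Orientable : ℕ → List ℤ → Set
Orientable n δ =
  ∃ λ (σ : Fin n → Bool) →
    ∀ (t t' : Fin n)
      (i : Fin (length (dedges (face δ (toℕ t) (σ t)))))
      (j : Fin (length (dedges (face δ (toℕ t') (σ t'))))) →
      let e  = lookup (dedges (face δ (toℕ t) (σ t))) i
          e' = lookup (dedges (face δ (toℕ t') (σ t'))) j
      in proj₁ e ≡[mod n ] proj₁ e' → proj₂ e ≡[mod n ] proj₂ e' →
         (t ≡ t') × (toℕ i ≡ toℕ j)

powPairs : ℕ → List ℤ
powPairs zero    = []
powPairs (suc i) = - (+ (3 ℕ.^ suc i)) ∷ - (+ (3 ℕ.^ suc i)) ∷ powPairs i

Dseq : ℕ → ℕ → List ℤ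
Dseq k r = a ∷ a ∷ powPairs (k ∸ 2)
  where a = - (+ (3 ℕ.^ (k ∸ 1) ℕ.+ r))

Dn : ℕ → ℕ → ℕ
Dn k r = (3 ℕ.^ k ∸ 1) ℕ.+ 2 ℕ.* r

module Submission where

-- Write k = N + 2 and c = 3^(N+1) + r.  Modulo n the base polygon is the
-- closed walk through the positions S 0 = 0, S 1, …, S (2k-1) whose steps
-- are 1, 1, 3, 3, …, 3^N, 3^N, c, c; these add up to n (S-closed).  Face t
-- is the translate of this walk by t, so each directed edge of face t
-- joins two consecutive positions t + S u and t + S (u+1) (edge-spec).
-- Every step length occurs exactly twice, in consecutive steps, and two
-- steps add up to less than n; hence equal edges of two faces come from
-- traversals in the same direction and steps of the same pair.
--  * r even: all steps are odd and n is even, so positions mod 2 tell the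
--    two steps of a pair apart, and orienting face t by the parity of t is
--    coherent (OddSteps.orientation-coherent).
--  * r odd: faces t and t+1 share the edge t+1 → t+2, and faces 0 and c
--    share the edge n-c → n; a coherent orientation would alternate along
--    t and differ on 0 and c, but c is even (Incoherence).

open import Defs
open import Data.Nat using (ℕ; _≤_; _%_)
open import Data.Product using (_×_)
open import Relation.Binary.PropositionalEquality using (_≡_)
open import Relation.Nullary using (¬_)

open import Data.Nat as ℕ using (zero; suc; _<_; z≤n; s≤s; _+_; _*_; _^_; _∸_; ⌊_/2⌋; NonZero)
import Data.Nat.Properties as ℕP
import Data.Nat.Divisibility as ℕD
open import Data.Nat.DivMod using (_/_; m≡m%n+[m/n]*n)
open import Data.Integer as ℤ using (ℤ; +_)
import Data.Integer.Properties as ℤP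
import Data.Integer.Divisibility.Signed as ℤD
import Data.Integer.Tactic.RingSolver as ℤSolver
import Data.Nat.Tactic.RingSolver as NatSolver
open import Data.Bool using (Bool; true; false; not)
import Data.Bool.Properties as BoolP
open import Data.Empty using (⊥; ⊥-elim)
open import Data.Sum using (inj₁; inj₂)
open import Data.Product using (Σ; _,_; proj₁; proj₂)
open import Data.List
  using (List; []; _∷_; _∷ʳ_; length; lookup; zip; map; reverse;
         applyUpTo; applyDownFrom; downFrom)
import Data.List.Properties as ListP
open import Data.Maybe using (Maybe; just; nothing)
import Data.Maybe.Properties as MaybeP
open import Data.Fin using (Fin; toℕ; fromℕ<)
import Data.Fin.Properties as FinP
open import Relation.Nullary using (yes; no)
open import Relation.Binary.Definitions using (tri<; tri≈; tri>)
open import Relation.Binary.Bundles using (Setoid)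
import Relation.Binary.Reasoning.Setoid
open import Relation.Binary.PropositionalEquality
  using (_≢_; refl; sym; trans; cong; cong₂; subst; subst₂; module ≡-Reasoning)

infix 4 _≈[_]_

-- This is the notion
-- _≡[mod_]_ of the statement, wrapped in a record (and phrased with
-- signed divisibility) so that a and b can be inferred from the type.
record _≈[_]_ (a : ℤ) (m : ℕ) (b : ℤ) : Set where
  constructor mod-divides
  field divides : + m ℤD.∣ (a ℤ.- b)
open _≈[_]_

≈⇒≡mod : ∀ {m a b} → a ≈[ m ] b → a ≡[mod m ] b
≈⇒≡mod h = ℤD.∣⇒∣ᵤ (divides h)

≡mod⇒≈ : ∀ {m a b} → a ≡[mod m ] b → a ≈[ m ] b
≡mod⇒≈ h = mod-divides (ℤD.∣ᵤ⇒∣ h)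

-- Every congruence is witnessed by a divisibility m ∣ x, where x is a
-- ring expression in a and b; this turns ring identities into congruences.
≈-via : ∀ {m a b} x → a ℤ.- b ≡ x → + m ℤD.∣ x → a ≈[ m ] b
≈-via {m} x eq h = mod-divides (subst (+ m ℤD.∣_) (sym eq) h)

≈-reflexive : ∀ {m a b} → a ≡ b → a ≈[ m ] b
≈-reflexive {m} {a} refl = ≈-via (+ 0) (ℤP.+-inverseʳ a) (ℤD.divides (+ 0) refl)

≈-refl : ∀ {m a} → a ≈[ m ] a
≈-refl = ≈-reflexive refl

≈-sym : ∀ {m a b} → a ≈[ m ] b → b ≈[ m ] a
≈-sym {a = a} {b} (mod-divides h) = ≈-via _ (eq a b) (ℤD.∣m⇒∣-m h)
  where
  eq : ∀ a b → b ℤ.- a ≡ ℤ.- (a ℤ.- b)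
  eq = ℤSolver.solve-∀

≈-trans : ∀ {m a b c} → a ≈[ m ] b → b ≈[ m ] c → a ≈[ m ] c
≈-trans {a = a} {b} {c} (mod-divides h) (mod-divides g) = ≈-via _ (eq a b c) (ℤD.∣m∣n⇒∣m+n h g)
  where
  eq : ∀ a b c → a ℤ.- c ≡ (a ℤ.- b) ℤ.+ (b ℤ.- c)
  eq = ℤSolver.solve-∀

≈-setoid : ℕ → Setoid _ _
≈-setoid m = record
  { Carrier = ℤ ; _≈_ = _≈[ m ]_
  ; isEquivalence = record { refl = ≈-refl ; sym = ≈-sym ; trans = ≈-trans } }

module ≈-Reasoning (m : ℕ) = Relation.Binary.Reasoning.Setoid (≈-setoid m)

≈-+ : ∀ {m a b x y} → a ≈[ m ] b → x ≈[ m ] y → a ℤ.+ x ≈[ m ] b ℤ.+ y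
≈-+ {a = a} {b} {x} {y} (mod-divides h) (mod-divides g) = ≈-via _ (eq a b x y) (ℤD.∣m∣n⇒∣m+n h g)
  where
  eq : ∀ a b x y → (a ℤ.+ x) ℤ.- (b ℤ.+ y) ≡ (a ℤ.- b) ℤ.+ (x ℤ.- y)
  eq = ℤSolver.solve-∀

≈-cancelˡ : ∀ {m a b x y} → a ℤ.+ x ≈[ m ] b ℤ.+ y → a ≈[ m ] b → x ≈[ m ] y
≈-cancelˡ {a = a} {b} {x} {y} (mod-divides h) (mod-divides g) = ≈-via _ (eq a b x y) (ℤD.∣m∣n⇒∣m-n h g)
  where
  eq : ∀ a b x y → x ℤ.- y ≡ ((a ℤ.+ x) ℤ.- (b ℤ.+ y)) ℤ.- (a ℤ.- b)
  eq = ℤSolver.solve-∀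

≈-cancelʳ : ∀ {m a b x y} → a ℤ.+ x ≈[ m ] b ℤ.+ y → x ≈[ m ] y → a ≈[ m ] b
≈-cancelʳ {m} {a} {b} {x} {y} h =
  ≈-cancelˡ (subst₂ _≈[ m ]_ (ℤP.+-comm a x) (ℤP.+-comm b y) h)

≈-minus-modulus : ∀ {m} a → a ℤ.- + m ≈[ m ] a
≈-minus-modulus {m} a = ≈-via _ (eq a (+ m)) (ℤD.divides (ℤ.- + 1) (eq' (+ m)))
  where
  eq : ∀ a m → a ℤ.- m ℤ.- a ≡ ℤ.- m
  eq = ℤSolver.solve-∀
  eq' : ∀ m → ℤ.- m ≡ ℤ.- + 1 ℤ.* m
  eq' = ℤSolver.solve-∀

≈-plus-multiple : ∀ {m} a k → + (a + k * m) ≈[ m ] + a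
≈-plus-multiple {m} a k = ≈-via (+ k ℤ.* + m) eq (ℤD.divides (+ k) refl)
  where
  ring : ∀ a km → a ℤ.+ km ℤ.- a ≡ km
  ring = ℤSolver.solve-∀
  eq : + (a + k * m) ℤ.- + a ≡ + k ℤ.* + m
  eq = trans (cong (ℤ._- + a) (trans (ℤP.pos-+ a (k * m)) (cong (λ z → + a ℤ.+ z) (ℤP.pos-* k m))))
             (ring (+ a) (+ k ℤ.* + m))

≈-+ℕ : ∀ {m a b x y} → + a ≈[ m ] + b → + x ≈[ m ] + y → + (a + x) ≈[ m ] + (b + y)
≈-+ℕ {m} {a} {b} {x} {y} h g =
  subst₂ _≈[ m ]_ (sym (ℤP.pos-+ a x)) (sym (ℤP.pos-+ b y)) (≈-+ h g)

≈-cancelˡℕ : ∀ {m a b x y} → + (a + x) ≈[ m ] + (b + y) → + a ≈[ m ] + b → + x ≈[ m ] + y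
≈-cancelˡℕ {m} {a} {b} {x} {y} h =
  ≈-cancelˡ (subst₂ _≈[ m ]_ (ℤP.pos-+ a x) (ℤP.pos-+ b y) h)

≈-cancelʳℕ : ∀ {m a b x y} → + (a + x) ≈[ m ] + (b + y) → + x ≈[ m ] + y → + a ≈[ m ] + b
≈-cancelʳℕ {m} {a} {b} {x} {y} h =
  ≈-cancelʳ (subst₂ _≈[ m ]_ (ℤP.pos-+ a x) (ℤP.pos-+ b y) h)

≈0⇒∣ : ∀ {m a} → + a ≈[ m ] + 0 → m ℕD.∣ a
≈0⇒∣ {m} {a} (mod-divides h) = ℤD.∣⇒∣ᵤ (subst (+ m ℤD.∣_) (ℤP.+-identityʳ (+ a)) h)

≈-mod : ∀ m .{{_ : NonZero m}} a → + a ≈[ m ] + (a % m)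
≈-mod m a = subst (λ x → + x ≈[ m ] + (a % m)) (sym (m≡m%n+[m/n]*n a m))
                  (≈-plus-multiple (a % m) (a / m))

≈-weaken : ∀ {m d a b} → d ℕD.∣ m → a ≈[ m ] b → a ≈[ d ] b
≈-weaken {m} {d} d∣m (mod-divides h) = mod-divides (ℤD.∣-trans (ℤD.∣ᵤ⇒∣ {+ d} {+ m} d∣m) h)

∣∧<⇒≡0 : ∀ {m x} → m ℕD.∣ x → x < m → x ≡ 0
∣∧<⇒≡0 {x = zero} _ _ = refl
∣∧<⇒≡0 {x = suc x} m∣x x<m = ⊥-elim (ℕP.<⇒≱ x<m (ℕD.∣⇒≤ m∣x))

≈-small-≤ : ∀ {m a b} → b ≤ a → a < m → + a ≈[ m ] + b → a ≡ b
≈-small-≤ {m} {a} {b} b≤a a<m (mod-divides h) = ℕP.≤-antisym (ℕP.m∸n≡0⇒m≤n a∸b≡0) b≤a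
  where
  a∸b≡0 : a ∸ b ≡ 0
  a∸b≡0 = ∣∧<⇒≡0 (ℤD.∣⇒∣ᵤ (subst (+ m ℤD.∣_) (trans (ℤP.m-n≡m⊖n a b) (ℤP.⊖-≥ b≤a)) h))
                 (ℕP.≤-<-trans (ℕP.m∸n≤m a b) a<m)

≈-small : ∀ {m a b} → a < m → b < m → + a ≈[ m ] + b → a ≡ b
≈-small {a = a} {b} a<m b<m h with ℕP.≤-total b a
... | inj₁ b≤a = ≈-small-≤ b≤a a<m h
... | inj₂ a≤b = sym (≈-small-≤ a≤b b<m (≈-sym h))

parity : ℕ → Bool
parity zero          = true
parity (suc zero)    = false
parity (suc (suc a)) = parity a

bit : Bool → ℕ
bit true  = 0
bit false = 1

≈₂-bit : ∀ a → + a ≈[ 2 ] + bit (parity a)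
≈₂-bit zero          = ≈-refl
≈₂-bit (suc zero)    = ≈-refl
≈₂-bit (suc (suc a)) =
  ≈-trans (subst (λ x → + x ≈[ 2 ] + a) (ℕP.+-comm a 2) (≈-plus-multiple a 1)) (≈₂-bit a)

parity⇒≈₂ : ∀ {a b} → parity a ≡ parity b → + a ≈[ 2 ] + b
parity⇒≈₂ {a} {b} eq =
  ≈-trans (≈₂-bit a) (subst (λ x → + bit x ≈[ 2 ] + b) (sym eq) (≈-sym (≈₂-bit b)))

≈₂⇒parity : ∀ {a b} → + a ≈[ 2 ] + b → parity a ≡ parity b
≈₂⇒parity {a} {b} h =
  bit-injective (≈-small (bit<2 (parity a)) (bit<2 (parity b))
                         (≈-trans (≈-sym (≈₂-bit a)) (≈-trans h (≈₂-bit b))))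
  where
  bit<2 : ∀ x → bit x < 2
  bit<2 true  = s≤s z≤n
  bit<2 false = s≤s (s≤s z≤n)
  bit-injective : ∀ {x y} → bit x ≡ bit y → x ≡ y
  bit-injective {true}  {true}  _ = refl
  bit-injective {false} {false} _ = refl

-- twice s = 2s, by a recursion matching that of ⌊_/2⌋.
twice : ℕ → ℕ
twice zero    = zero
twice (suc s) = suc (suc (twice s))

half-twice : ∀ s → ⌊ twice s /2⌋ ≡ s
half-twice zero    = refl
half-twice (suc s) = cong suc (half-twice s)

half-suc-twice : ∀ s → ⌊ suc (twice s) /2⌋ ≡ s
half-suc-twice zero    = refl
half-suc-twice (suc s) = cong suc (half-suc-twice s)

half-parity-injective : ∀ p q → ⌊ p /2⌋ ≡ ⌊ q /2⌋ → parity p ≡ parity q → p ≡ q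
half-parity-injective zero          zero          _ _ = refl
half-parity-injective (suc zero)    (suc zero)    _ _ = refl
half-parity-injective (suc (suc p)) (suc (suc q)) h e =
  cong (λ x → suc (suc x)) (half-parity-injective p q (ℕP.suc-injective h) e)
half-parity-injective zero          (suc zero)    _ ()
half-parity-injective (suc zero)    zero          _ ()
half-parity-injective zero          (suc (suc q)) () _
half-parity-injective (suc zero)    (suc (suc q)) () _
half-parity-injective (suc (suc p)) zero          () _
half-parity-injective (suc (suc p)) (suc zero)    () _

-- Lookup by a natural-number index (nothing when out of range); unlike
-- lookup it is insensitive to how the length of the list is written.
at : ∀ {A : Set} → List A → ℕ → Maybe A
at []       _       = nothing
at (x ∷ xs) zero    = just x
at (x ∷ xs) (suc p) = at xs p

module _ {A : Set} where

  at-lookup : (xs : List A) (i : Fin (length xs)) → at xs (toℕ i) ≡ just (lookup xs i)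
  at-lookup (x ∷ xs) Data.Fin.zero    = refl
  at-lookup (x ∷ xs) (Data.Fin.suc i) = at-lookup xs i

  at-∷ʳ-< : ∀ (xs : List A) y {p} → p < length xs → at (xs ∷ʳ y) p ≡ at xs p
  at-∷ʳ-< (x ∷ xs) y {zero}  _         = refl
  at-∷ʳ-< (x ∷ xs) y {suc p} (s≤s p<) = at-∷ʳ-< xs y p<

  at-∷ʳ-last : ∀ (xs : List A) y {p} → p ≡ length xs → at (xs ∷ʳ y) p ≡ just y
  at-∷ʳ-last []       y refl = refl
  at-∷ʳ-last (x ∷ xs) y refl = at-∷ʳ-last xs y refl

  at-applyUpTo : ∀ (f : ℕ → A) {m p} → p < m → at (applyUpTo f m) p ≡ just (f p)
  at-applyUpTo f {suc m} {zero}  _         = refl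
  at-applyUpTo f {suc m} {suc p} (s≤s p<) = at-applyUpTo (λ q → f (suc q)) p<

  at-applyDownFrom : ∀ (f : ℕ → A) {m p} → p < m → at (applyDownFrom f m) p ≡ just (f (m ∸ suc p))
  at-applyDownFrom f {suc m} {zero}  _         = refl
  at-applyDownFrom f {suc m} {suc p} (s≤s p<) = at-applyDownFrom f p<

traverse : Bool → (ℕ → ℤ) → ℕ → List ℤ
traverse true  g m = applyUpTo g m
traverse false g m = applyDownFrom g m

applyDownFrom-cong : ∀ {A : Set} {f g : ℕ → A} → (∀ q → f q ≡ g q) → ∀ m →
                     applyDownFrom f m ≡ applyDownFrom g m
applyDownFrom-cong {f = f} {g} f≗g m =
  trans (sym (ListP.map-downFrom f m)) (trans (ListP.map-cong f≗g (downFrom m)) (ListP.map-downFrom g m))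

dedges-applyUpTo : ∀ (g : ℕ → ℤ) m →
  dedges (applyUpTo g (suc m)) ≡ applyUpTo (λ p → g p , g (suc p)) m ∷ʳ (g m , g 0)
dedges-applyUpTo g m = zip-shift g m (g 0)
  where
  zip-shift : ∀ (g : ℕ → ℤ) m z →
    zip (applyUpTo g (suc m)) (applyUpTo (λ p → g (suc p)) m ∷ʳ z)
      ≡ applyUpTo (λ p → g p , g (suc p)) m ∷ʳ (g m , z)
  zip-shift g zero    z = refl
  zip-shift g (suc m) z = cong ((g 0 , g 1) ∷_) (zip-shift (λ p → g (suc p)) m z)

dedges-applyDownFrom : ∀ (g : ℕ → ℤ) m →
  dedges (applyDownFrom g (suc m)) ≡ applyDownFrom (λ p → g (suc p) , g p) m ∷ʳ (g 0 , g m)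
dedges-applyDownFrom g m = zip-shift m (g m)
  where
  zip-shift : ∀ m z →
    zip (g m ∷ applyDownFrom g m) (applyDownFrom g m ∷ʳ z)
      ≡ applyDownFrom (λ p → g (suc p) , g p) m ∷ʳ (g 0 , z)
  zip-shift zero    z = refl
  zip-shift (suc m) z = cong ((g (suc m) , g m) ∷_) (zip-shift m z)

length-dedges : ∀ xs → length (dedges xs) ≡ length xs
length-dedges xs =
  trans (ListP.length-zipWith _,_ xs (rotate xs))
        (trans (cong (length xs ℕ.⊓_) (length-rotate xs)) (ℕP.⊓-idem (length xs)))
  where
  length-rotate : ∀ xs → length (rotate xs) ≡ length xs
  length-rotate []       = refl
  length-rotate (x ∷ xs) = trans (ListP.length-++ xs) (ℕP.+-comm (length xs) 1)

length-traverse : ∀ b g m → length (traverse b g m) ≡ m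
length-traverse true  g m = ListP.length-applyUpTo g m
length-traverse false g m = ListP.length-applyDownFrom g m

-- The p-th edge of the backward traversal of positions 0 … m joins
-- position mirror m p + 1 to position mirror m p.
mirror : ℕ → ℕ → ℕ
mirror m p with p ℕ.<? m
... | yes _ = m ∸ suc p
... | no  _ = m

mirror-< : ∀ {m p} → p < m → mirror m p ≡ m ∸ suc p
mirror-< {m} {p} p<m with p ℕ.<? m
... | yes _   = refl
... | no p≮m = ⊥-elim (p≮m p<m)

mirror-last : ∀ m → mirror m m ≡ m
mirror-last m with m ℕ.<? m
... | yes m<m = ⊥-elim (ℕP.<-irrefl refl m<m)
... | no  _   = refl

mirror-≤ : ∀ {m p} → p ≤ m → mirror m p ≤ m
mirror-≤ {m} {p} p≤m with ℕP.m≤n⇒m<n∨m≡n p≤m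
... | inj₁ p<m  = ℕP.≤-trans (ℕP.≤-reflexive (mirror-< p<m)) (ℕP.m∸n≤m m (suc p))
... | inj₂ refl = ℕP.≤-reflexive (mirror-last m)

mirror-involutive : ∀ {m p} → p ≤ m → mirror m (mirror m p) ≡ p
mirror-involutive {m} {p} p≤m with ℕP.m≤n⇒m<n∨m≡n p≤m
... | inj₂ refl = trans (cong (mirror m) (mirror-last m)) (mirror-last m)
mirror-involutive {suc m} {p} _ | inj₁ (s≤s p≤m) = begin
  mirror (suc m) (mirror (suc m) p) ≡⟨ cong (mirror (suc m)) (mirror-< (s≤s p≤m)) ⟩
  mirror (suc m) (m ∸ p)            ≡⟨ mirror-< (s≤s (ℕP.m∸n≤m m p)) ⟩
  m ∸ (m ∸ p)                       ≡⟨ ℕP.m∸[m∸n]≡n p≤m ⟩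
  p                                 ∎
  where open ≡-Reasoning

-- Position of the p-th edge of a traversal of 0 … m: that edge joins
-- positions slot m b p and slot m b p + 1.
slot : ℕ → Bool → ℕ → ℕ
slot m true  p = p
slot m false p = mirror m p

slot-≤ : ∀ {m} b {p} → p ≤ m → slot m b p ≤ m
slot-≤ true  p≤m = p≤m
slot-≤ false p≤m = mirror-≤ p≤m

slot-involutive : ∀ {m} b {p} → p ≤ m → slot m b (slot m b p) ≡ p
slot-involutive true  _   = refl
slot-involutive false p≤m = mirror-involutive p≤m

slot-injective : ∀ {m} b {p q} → p ≤ m → q ≤ m → slot m b p ≡ slot m b q → p ≡ q
slot-injective {m} b {p} {q} p≤m q≤m eq =
  trans (sym (slot-involutive b p≤m)) (trans (cong (slot m b) eq) (slot-involutive b q≤m))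

orient : Bool → ℤ × ℤ → ℤ × ℤ
orient true  e       = e
orient false (x , y) = (y , x)

module _ (g : ℕ → ℤ) {m : ℕ} where

  at-dedges-forward : ∀ {p} → p < m → at (dedges (applyUpTo g (suc m))) p ≡ just (g p , g (suc p))
  at-dedges-forward {p} p<m = begin
    at (dedges (applyUpTo g (suc m))) p ≡⟨ cong (λ xs → at xs p) (dedges-applyUpTo g m) ⟩
    at (edges ∷ʳ (g m , g 0)) p       ≡⟨ at-∷ʳ-< edges _ p<length ⟩
    at edges p                         ≡⟨ at-applyUpTo _ p<m ⟩
    just (g p , g (suc p))             ∎
    where
    open ≡-Reasoning
    edges : List (ℤ × ℤ)
    edges = applyUpTo (λ p → g p , g (suc p)) m
    p<length : p < length edges
    p<length = subst (p <_) (sym (ListP.length-applyUpTo _ m)) p<m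

  at-dedges-forward-last : at (dedges (applyUpTo g (suc m))) m ≡ just (g m , g 0)
  at-dedges-forward-last =
    trans (cong (λ xs → at xs m) (dedges-applyUpTo g m))
          (at-∷ʳ-last (applyUpTo (λ p → g p , g (suc p)) m) _ (sym (ListP.length-applyUpTo _ m)))

  at-dedges-backward : ∀ {p} → p < m →
    at (dedges (applyDownFrom g (suc m))) p ≡ just (g (suc (m ∸ suc p)) , g (m ∸ suc p))
  at-dedges-backward {p} p<m = begin
    at (dedges (applyDownFrom g (suc m))) p ≡⟨ cong (λ xs → at xs p) (dedges-applyDownFrom g m) ⟩
    at (edges ∷ʳ (g 0 , g m)) p           ≡⟨ at-∷ʳ-< edges _ p<length ⟩
    at edges p                             ≡⟨ at-applyDownFrom _ p<m ⟩
    just (g (suc (m ∸ suc p)) , g (m ∸ suc p)) ∎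
    where
    open ≡-Reasoning
    edges : List (ℤ × ℤ)
    edges = applyDownFrom (λ p → g (suc p) , g p) m
    p<length : p < length edges
    p<length = subst (p <_) (sym (ListP.length-applyDownFrom _ m)) p<m

  at-dedges-backward-last : at (dedges (applyDownFrom g (suc m))) m ≡ just (g 0 , g m)
  at-dedges-backward-last =
    trans (cong (λ xs → at xs m) (dedges-applyDownFrom g m))
          (at-∷ʳ-last (applyDownFrom (λ p → g (suc p) , g p) m) _ (sym (ListP.length-applyDownFrom _ m)))

infix 4 _≈²[_]_

record _≈²[_]_ (e : ℤ × ℤ) (m : ℕ) (e' : ℤ × ℤ) : Set where
  constructor _,_
  field
    first  : proj₁ e ≈[ m ] proj₁ e'
    second : proj₂ e ≈[ m ] proj₂ e'
open _≈²[_]_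

≈²-reflexive : ∀ {m e e'} → e ≡ e' → e ≈²[ m ] e'
≈²-reflexive refl = ≈-refl , ≈-refl

≈²-sym : ∀ {m e e'} → e ≈²[ m ] e' → e' ≈²[ m ] e
≈²-sym (h₁ , h₂) = ≈-sym h₁ , ≈-sym h₂

≈²-trans : ∀ {m e e' e''} → e ≈²[ m ] e' → e' ≈²[ m ] e'' → e ≈²[ m ] e''
≈²-trans (h₁ , h₂) (g₁ , g₂) = ≈-trans h₁ g₁ , ≈-trans h₂ g₂

module ClosedPolygon {n : ℕ} (m : ℕ) (G g : ℕ → ℤ)
         (vertex : ∀ p → g p ≈[ n ] G p) (closed : G (suc m) ≈[ n ] G 0) where

  wrap : g 0 ≈[ n ] G (suc m)
  wrap = ≈-trans (vertex 0) (≈-sym closed)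

  edge-position : ∀ b {p e} → p ≤ m → at (dedges (traverse b g (suc m))) p ≡ just e →
                  e ≈²[ n ] orient b (G (slot m b p) , G (suc (slot m b p)))
  edge-position true {p} p≤m h with ℕP.m≤n⇒m<n∨m≡n p≤m
  ... | inj₁ p<m with MaybeP.just-injective (trans (sym h) (at-dedges-forward g p<m))
  ...   | refl = vertex p , vertex (suc p)
  edge-position true {p} p≤m h | inj₂ refl
    with MaybeP.just-injective (trans (sym h) (at-dedges-forward-last g {m}))
  ...   | refl = vertex m , wrap
  edge-position false {p} p≤m h with ℕP.m≤n⇒m<n∨m≡n p≤m
  ... | inj₁ p<m rewrite mirror-< p<m with MaybeP.just-injective (trans (sym h) (at-dedges-backward g p<m))
  ...   | refl = vertex _ , vertex _
  edge-position false {p} p≤m h | inj₂ refl rewrite mirror-last m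
    with MaybeP.just-injective (trans (sym h) (at-dedges-backward-last g {m}))
  ...   | refl = wrap , vertex m

module Polygon (N r : ℕ) where

  c : ℕ
  c = 3 ^ suc N + r

  n : ℕ
  n = Dn (suc (suc N)) r

  δ : List ℤ
  δ = Dseq (suc (suc N)) r

  E : ℕ → ℕ
  E s with s ℕ.≤? N
  ... | yes _ = 3 ^ s
  ... | no  _ = c

  d : ℕ → ℕ
  d q = E ⌊ q /2⌋

  -- S p is the position of the p-th vertex of the base polygon.
  S : ℕ → ℕ
  S zero    = zero
  S (suc q) = S q + d q

  -- The polygon has the 2k vertices 0, …, L1.
  L1 : ℕ
  L1 = suc (twice (suc N))

  E-low : ∀ {s} → s ≤ N → E s ≡ 3 ^ s
  E-low {s} s≤N with s ℕ.≤? N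
  ... | yes _   = refl
  ... | no s≰N = ⊥-elim (s≰N s≤N)

  E-top : E (suc N) ≡ c
  E-top with suc N ℕ.≤? N
  ... | yes N<N = ⊥-elim (ℕP.<-irrefl refl N<N)
  ... | no  _   = refl

  d-twice : ∀ s → d (twice s) ≡ E s
  d-twice s = cong E (half-twice s)

  d-suc-twice : ∀ s → d (suc (twice s)) ≡ E s
  d-suc-twice s = cong E (half-suc-twice s)

  S-pair : ∀ {s} → s ≤ N → S (twice (suc s)) ≡ S (twice s) + 3 ^ s + 3 ^ s
  S-pair {s} s≤N = cong₂ (λ x y → S (twice s) + x + y)
                         (trans (d-twice s) (E-low s≤N)) (trans (d-suc-twice s) (E-low s≤N))

  S-twice : ∀ s → s ≤ suc N → S (twice s) + 1 ≡ 3 ^ s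
  S-twice zero    _         = refl
  S-twice (suc s) (s≤s s≤N) = begin
    S (twice (suc s)) + 1           ≡⟨ cong (_+ 1) (S-pair s≤N) ⟩
    S (twice s) + 3 ^ s + 3 ^ s + 1 ≡⟨ rearrange (S (twice s)) (3 ^ s) ⟩
    (S (twice s) + 1) + 2 * 3 ^ s   ≡⟨ cong (_+ 2 * 3 ^ s) (S-twice s (ℕP.m≤n⇒m≤1+n s≤N)) ⟩
    3 ^ s + 2 * 3 ^ s               ≡⟨⟩
    3 ^ suc s                       ∎
    where
    open ≡-Reasoning
    rearrange : ∀ x y → x + y + y + 1 ≡ (x + 1) + 2 * y
    rearrange = NatSolver.solve-∀

  X : ℕ
  X = S (twice (suc N))

  X+1 : X + 1 ≡ 3 ^ suc N
  X+1 = S-twice (suc N) ℕP.≤-refl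

  S-L1 : S L1 ≡ X + c
  S-L1 = cong (λ z → X + z) (trans (d-twice (suc N)) E-top)

  n≡X+c+c : n ≡ X + c + c
  n≡X+c+c = begin
    (3 ^ suc (suc N) ∸ 1) + 2 * r ≡⟨ cong (λ z → (3 * z ∸ 1) + 2 * r) (sym X+1') ⟩
    (3 * suc X ∸ 1) + 2 * r       ≡⟨ expand X r ⟩
    X + (suc X + r) + (suc X + r) ≡⟨ cong (λ z → X + (z + r) + (z + r)) X+1' ⟩
    X + c + c                     ∎
    where
    open ≡-Reasoning
    X+1' : suc X ≡ 3 ^ suc N
    X+1' = trans (ℕP.+-comm 1 X) X+1
    -- 3 * suc x ∸ 1 computes to x + (suc x + (suc x + 0)).
    expand : ∀ x r → (3 * suc x ∸ 1) + 2 * r ≡ x + (suc x + r) + (suc x + r)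
    expand x r = computed x r
      where
      computed : ∀ x r → x + (suc x + (suc x + 0)) + 2 * r ≡ x + (suc x + r) + (suc x + r)
      computed = NatSolver.solve-∀

  S-closed : S (suc L1) ≡ n
  S-closed = trans (cong₂ _+_ S-L1 (trans (d-suc-twice (suc N)) E-top)) (sym n≡X+c+c)

  c-positive : 0 < c
  c-positive = ℕP.<-≤-trans (ℕP.m^n>0 3 (suc N)) (ℕP.m≤m+n _ r)

  E-positive : ∀ s → 0 < E s
  E-positive s with s ℕ.≤? N
  ... | yes _ = ℕP.m^n>0 3 s
  ... | no  _ = c-positive

  E-≤-c : ∀ s → E s ≤ c
  E-≤-c s with s ℕ.≤? N
  ... | yes s≤N = ℕP.≤-trans (ℕP.^-monoʳ-≤ 3 (ℕP.m≤n⇒m≤1+n s≤N)) (ℕP.m≤m+n _ r)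
  ... | no  _   = ℕP.≤-refl

  X-positive : 0 < X
  X-positive = ℕP.≤-trans (s≤s z≤n)
    (ℕP.≤-pred (subst (3 ≤_) (sym (trans (ℕP.+-comm 1 X) X+1)) (ℕP.*-monoʳ-≤ 3 (ℕP.m^n>0 3 N))))

  c+c<n : c + c < n
  c+c<n = subst (c + c <_) (trans (sym (ℕP.+-assoc X c c)) (sym n≡X+c+c)) (ℕP.m<n+m (c + c) X-positive)

  c<n : c < n
  c<n = ℕP.≤-<-trans (ℕP.m≤m+n c c) c+c<n

  d+d<n : ∀ p q → d p + d q < n
  d+d<n p q = ℕP.≤-<-trans (ℕP.+-mono-≤ (E-≤-c ⌊ p /2⌋) (E-≤-c ⌊ q /2⌋)) c+c<n

  d<n : ∀ q → d q < n
  d<n q = ℕP.≤-<-trans (ℕP.m≤m+n (d q) (d q)) (d+d<n q q)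

  -- E is strictly increasing up to the top step, so a step length
  -- determines the pair of steps it belongs to.
  pow-≤-E : ∀ {s} → s ≤ suc N → 3 ^ s ≤ E s
  pow-≤-E {s} s≤ with s ℕ.≤? N
  ... | yes _ = ℕP.≤-refl
  ... | no  _ = ℕP.≤-trans (ℕP.^-monoʳ-≤ 3 s≤) (ℕP.m≤m+n _ r)

  E-< : ∀ {s s'} → s < s' → s' ≤ suc N → E s < E s'
  E-< {s} {s'} s<s' s'≤ = begin-strict
    E s    ≡⟨ E-low (ℕP.≤-pred (ℕP.<-≤-trans s<s' s'≤)) ⟩
    3 ^ s  <⟨ ℕP.^-monoʳ-< 3 (s≤s (s≤s z≤n)) s<s' ⟩
    3 ^ s' ≤⟨ pow-≤-E s'≤ ⟩
    E s'   ∎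
    where open ℕP.≤-Reasoning

  E-injective : ∀ {s s'} → s ≤ suc N → s' ≤ suc N → E s ≡ E s' → s ≡ s'
  E-injective {s} {s'} s≤ s'≤ eq with ℕP.<-cmp s s'
  ... | tri< s<s' _ _ = ⊥-elim (ℕP.<-irrefl eq (E-< s<s' s'≤))
  ... | tri≈ _ s≡s' _ = s≡s'
  ... | tri> _ _ s'<s = ⊥-elim (ℕP.<-irrefl (sym eq) (E-< s'<s s≤))

  half-≤ : ∀ {p} → p ≤ L1 → ⌊ p /2⌋ ≤ suc N
  half-≤ {p} p≤L1 = subst (⌊ p /2⌋ ≤_) (half-suc-twice (suc N)) (ℕP.⌊n/2⌋-mono p≤L1)

  d-injective : ∀ {p q} → p ≤ L1 → q ≤ L1 → d p ≡ d q → ⌊ p /2⌋ ≡ ⌊ q /2⌋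
  d-injective p≤ q≤ = E-injective (half-≤ p≤) (half-≤ q≤)

  pow3-odd : ∀ s → + (3 ^ s) ≈[ 2 ] + 1
  pow3-odd zero    = ≈-refl
  pow3-odd (suc s) =
    ≈-trans (subst (λ x → + (3 ^ s + x) ≈[ 2 ] + (3 ^ s)) (ℕP.*-comm (3 ^ s) 2)
                   (≈-plus-multiple (3 ^ s) (3 ^ s)))
            (pow3-odd s)

  c≈1+r : + c ≈[ 2 ] + (1 + r)
  c≈1+r = ≈-+ℕ (pow3-odd (suc N)) ≈-refl

  n-even : + n ≈[ 2 ] + 0
  n-even = subst (λ x → + x ≈[ 2 ] + 0) (sym n≡X+c·2) (≈-trans (≈-plus-multiple X c) X-even)
    where
    X-even : + X ≈[ 2 ] + 0
    X-even = ≈-cancelʳ {x = + 1} {y = + 1}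
      (subst₂ _≈[ 2 ]_ (trans (cong +_ (sym X+1)) (ℤP.pos-+ X 1)) refl (pow3-odd (suc N))) ≈-refl
    n≡X+c·2 : n ≡ X + c * 2
    n≡X+c·2 = trans n≡X+c+c (regroup X c)
      where
      regroup : ∀ x c → x + c + c ≡ x + c * 2
      regroup = NatSolver.solve-∀

  2∣n : 2 ℕD.∣ n
  2∣n = ≈0⇒∣ n-even

  G : ℕ → ℕ → ℤ
  G t p = + (t + S p)

  G-suc : ∀ t p → G t (suc p) ≡ G t p ℤ.+ + d p
  G-suc t p = trans (cong +_ (sym (ℕP.+-assoc t (S p) (d p)))) (ℤP.pos-+ (t + S p) (d p))

  G-unit-step : ∀ t p → d p ≡ 1 → G t (suc p) ≡ G (suc t) p
  G-unit-step t p dp≡1 = cong +_ (begin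
    t + (S p + d p) ≡⟨ cong (λ z → t + (S p + z)) dp≡1 ⟩
    t + (S p + 1)   ≡⟨ cong (λ z → t + z) (ℕP.+-comm (S p) 1) ⟩
    t + suc (S p)   ≡⟨ ℕP.+-suc t (S p) ⟩
    suc t + S p     ∎)
    where open ≡-Reasoning

  G-closed : ∀ t → G t (suc L1) ≈[ n ] G t 0
  G-closed t = subst₂ _≈[ n ]_ (cong (λ z → + (t + z)) (trans (ℕP.*-identityˡ n) (sym S-closed)))
                               (cong +_ (sym (ℕP.+-identityʳ t)))
                               (≈-plus-multiple t 1)

  S-1 : S 1 ≡ 1
  S-1 = E-low z≤n

  S-2 : S 2 ≡ 2
  S-2 = cong₂ _+_ S-1 (E-low z≤n)

  -- The vertices 0, 1, 2, w_{2k-3}, …, w_1 of the base polygon; the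
  -- partial sums w_j turn out to be the positions S p shifted by -n.
  base : ℕ → ℤ
  base zero                   = + 0
  base (suc zero)             = + 1
  base (suc (suc zero))       = + 2
  base p@(suc (suc (suc _))) = + S p ℤ.- + n

  base-≈ : ∀ p → base p ≈[ n ] + S p
  base-≈ zero                   = ≈-refl
  base-≈ (suc zero)             = ≈-reflexive (cong +_ (sym S-1))
  base-≈ (suc (suc zero))       = ≈-reflexive (cong +_ (sym S-2))
  base-≈ (suc (suc (suc p)))    = ≈-minus-modulus (+ S (3 + p))

  vertex : ℕ → ℕ → ℤ
  vertex t p = + t ℤ.+ base p

  vertex-≈ : ∀ t p → vertex t p ≈[ n ] G t p
  vertex-≈ t p = subst (vertex t p ≈[ n ]_) (sym (ℤP.pos-+ t (S p))) (≈-+ {a = + t} ≈-refl (base-≈ p))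

  +S-second-of-pair : ∀ {s} → s ≤ N → + S (twice (suc s)) ≡ + S (suc (twice s)) ℤ.+ + (3 ^ s)
  +S-second-of-pair {s} s≤N =
    trans (cong (λ z → + (S (suc (twice s)) + z)) (trans (d-suc-twice s) (E-low s≤N)))
          (ℤP.pos-+ (S (suc (twice s))) (3 ^ s))

  +S-pair : ∀ {s} → s ≤ N → + S (twice (suc s)) ≡ + S (twice s) ℤ.+ + (3 ^ s) ℤ.+ + (3 ^ s)
  +S-pair {s} s≤N = trans (cong +_ (S-pair s≤N))
    (trans (ℤP.pos-+ (S (twice s) + 3 ^ s) (3 ^ s)) (cong (ℤ._+ + (3 ^ s)) (ℤP.pos-+ (S (twice s)) (3 ^ s))))

  initSums-powPairs : ∀ {M} acc x → M ≤ N →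
    initSums acc (x ∷ powPairs M)
      ≡ applyDownFrom (λ q → acc ℤ.+ x ℤ.+ + S (3 + q) ℤ.- + S (twice (suc M))) (twice M)
  initSums-powPairs {zero}  acc x _   = refl
  initSums-powPairs {suc M} acc x M<N = begin
    a ∷ (a ℤ.+ y) ∷ initSums (a ℤ.+ y) (y ∷ powPairs M)
      ≡⟨ cong (λ l → a ∷ (a ℤ.+ y) ∷ l) (initSums-powPairs (a ℤ.+ y) y (ℕP.<⇒≤ M<N)) ⟩
    a ∷ (a ℤ.+ y) ∷ applyDownFrom h′ (twice M)
      ≡⟨ cong₂ (λ u v → u ∷ v ∷ applyDownFrom h′ (twice M)) head₁ head₂ ⟩
    h (suc (twice M)) ∷ h (twice M) ∷ applyDownFrom h′ (twice M)
      ≡⟨ cong (λ l → h (suc (twice M)) ∷ h (twice M) ∷ l) (applyDownFrom-cong tail (twice M)) ⟩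
    applyDownFrom h (twice (suc M)) ∎
    where
    open ≡-Reasoning
    a Y y : ℤ
    a = acc ℤ.+ x
    Y = + (3 ^ suc M)
    y = ℤ.- Y
    h h′ : ℕ → ℤ
    h  q = a ℤ.+ + S (3 + q) ℤ.- + S (twice (suc (suc M)))
    h′ q = a ℤ.+ y ℤ.+ y ℤ.+ + S (3 + q) ℤ.- + S (twice (suc M))
    head₁ : a ≡ h (suc (twice M))
    head₁ = ring a (+ S (twice (suc (suc M))))
      where
      ring : ∀ a s → a ≡ a ℤ.+ s ℤ.- s
      ring = ℤSolver.solve-∀
    head₂ : a ℤ.+ y ≡ h (twice M)
    head₂ = trans (ring a (+ S (3 + twice M)) Y)
                  (cong (λ z → a ℤ.+ + S (3 + twice M) ℤ.- z) (sym (+S-second-of-pair M<N)))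
      where
      ring : ∀ a s Y → a ℤ.+ ℤ.- Y ≡ a ℤ.+ s ℤ.- (s ℤ.+ Y)
      ring = ℤSolver.solve-∀
    tail : ∀ q → h′ q ≡ h q
    tail q = trans (ring a (+ S (3 + q)) (+ S (twice (suc M))) Y)
                   (cong (λ z → a ℤ.+ + S (3 + q) ℤ.- z) (sym (+S-pair M<N)))
      where
      ring : ∀ a s T Y → a ℤ.+ ℤ.- Y ℤ.+ ℤ.- Y ℤ.+ s ℤ.- T ≡ a ℤ.+ s ℤ.- (T ℤ.+ Y ℤ.+ Y)
      ring = ℤSolver.solve-∀

  basePolygon-shape : basePolygon δ ≡ applyUpTo base (suc L1)
  basePolygon-shape = cong (λ l → + 0 ∷ + 1 ∷ + 2 ∷ l) (begin
    reverse (initSums (+ 0) δ)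
      ≡⟨ cong (λ l → reverse (w ∷ l)) (initSums-powPairs w y ℕP.≤-refl) ⟩
    reverse (w ∷ applyDownFrom h (twice N))
      ≡⟨ cong₂ (λ u l → reverse (u ∷ l)) head (applyDownFrom-cong tail (twice N)) ⟩
    reverse (applyDownFrom (λ q → base (3 + q)) (suc (twice N)))
      ≡⟨ ListP.reverse-applyDownFrom (λ q → base (3 + q)) (suc (twice N)) ⟩
    applyUpTo (λ q → base (3 + q)) (suc (twice N)) ∎)
    where
    open ≡-Reasoning
    y w : ℤ
    y = ℤ.- + c
    w = + 0 ℤ.+ y
    h : ℕ → ℤ
    h q = w ℤ.+ y ℤ.+ + S (3 + q) ℤ.- + X
    +n : + n ≡ + X ℤ.+ + c ℤ.+ + c
    +n = trans (cong +_ n≡X+c+c) (trans (ℤP.pos-+ (X + c) c) (cong (ℤ._+ + c) (ℤP.pos-+ X c)))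
    head : w ≡ base L1
    head = trans (ring (+ X) (+ c)) (cong₂ ℤ._-_ (sym (trans (cong +_ S-L1) (ℤP.pos-+ X c))) (sym +n))
      where
      ring : ∀ X c → + 0 ℤ.+ ℤ.- c ≡ (X ℤ.+ c) ℤ.- (X ℤ.+ c ℤ.+ c)
      ring = ℤSolver.solve-∀
    tail : ∀ q → h q ≡ base (3 + q)
    tail q = trans (ring (+ X) (+ c) (+ S (3 + q))) (cong (λ z → + S (3 + q) ℤ.- z) (sym +n))
      where
      ring : ∀ X c s → + 0 ℤ.+ ℤ.- c ℤ.+ ℤ.- c ℤ.+ s ℤ.- X ≡ s ℤ.- (X ℤ.+ c ℤ.+ c)
      ring = ℤSolver.solve-∀

  face-shape : ∀ t b → face δ t b ≡ traverse b (vertex t) (suc L1)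
  face-shape t true  = trans (cong (map (λ v → + t ℤ.+ v)) basePolygon-shape)
                             (ListP.map-applyUpTo base (λ v → + t ℤ.+ v) (suc L1))
  face-shape t false = trans (cong reverse (face-shape t true)) (ListP.reverse-applyUpTo (vertex t) (suc L1))

  Edges : ℕ → Bool → List (ℤ × ℤ)
  Edges t b = dedges (face δ t b)

  length-Edges : ∀ t b → length (Edges t b) ≡ suc L1
  length-Edges t b = trans (length-dedges (face δ t b))
                           (trans (cong length (face-shape t b)) (length-traverse b (vertex t) (suc L1)))

  index-≤ : ∀ t b (i : Fin (length (Edges t b))) → toℕ i ≤ L1
  index-≤ t b i = ℕP.≤-pred (subst (toℕ i <_) (length-Edges t b) (FinP.toℕ<n i))

  edge-spec : ∀ t b (i : Fin (length (Edges t b))) →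
    lookup (Edges t b) i ≈²[ n ] orient b (G t (slot L1 b (toℕ i)) , G t (suc (slot L1 b (toℕ i))))
  edge-spec t b i =
    ClosedPolygon.edge-position L1 (G t) (vertex t) (vertex-≈ t) (G-closed t) b (index-≤ t b i)
      (trans (cong (λ f → at (dedges f) (toℕ i)) (sym (face-shape t b))) (at-lookup (Edges t b) i))

  edge-at : ∀ t b {u} → u ≤ L1 → Σ (Fin (length (Edges t b))) λ i → slot L1 b (toℕ i) ≡ u
  edge-at t b {u} u≤ = fromℕ< p< , trans (cong (slot L1 b) (FinP.toℕ-fromℕ< p<)) (slot-involutive b u≤)
    where
    p< : slot L1 b u < length (Edges t b)
    p< = subst (slot L1 b u <_) (sym (length-Edges t b)) (s≤s (slot-≤ b u≤))

  -- Faces sharing an edge traversed in opposite directions would need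
  -- two steps adding up to a multiple of n.
  opposite-directions : ∀ t t' p q → G t p ≈[ n ] G t' (suc q) → G t (suc p) ≈[ n ] G t' q → ⊥
  opposite-directions t t' p q h₁ h₂ =
    ℕP.<-irrefl (sym (≈-small (d+d<n q p) (ℕP.≤-<-trans z≤n c<n) sum≈0))
                (ℕP.<-≤-trans (E-positive ⌊ q /2⌋) (ℕP.m≤m+n (d q) (d p)))
    where
    open ≈-Reasoning n
    sum≈0 : + (d q + d p) ≈[ n ] + 0
    sum≈0 = ≈-cancelˡ {a = G t' q} (begin
      G t' q ℤ.+ + (d q + d p)       ≡⟨ cong (λ z → G t' q ℤ.+ z) (ℤP.pos-+ (d q) (d p)) ⟩
      G t' q ℤ.+ (+ d q ℤ.+ + d p)   ≡⟨ sym (ℤP.+-assoc (G t' q) (+ d q) (+ d p)) ⟩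
      G t' q ℤ.+ + d q ℤ.+ + d p     ≡⟨ cong (ℤ._+ + d p) (sym (G-suc t' q)) ⟩
      G t' (suc q) ℤ.+ + d p         ≈⟨ ≈-+ {x = + d p} (≈-sym h₁) ≈-refl ⟩
      G t p ℤ.+ + d p                ≡⟨ sym (G-suc t p) ⟩
      G t (suc p)                    ≈⟨ h₂ ⟩
      G t' q                         ≡⟨ sym (ℤP.+-identityʳ (G t' q)) ⟩
      G t' q ℤ.+ + 0                 ∎) ≈-refl

  Coherent : (Fin n → Bool) → Set
  Coherent σ =
    ∀ (t t' : Fin n) (i : Fin (length (Edges (toℕ t) (σ t)))) (j : Fin (length (Edges (toℕ t') (σ t')))) →
      proj₁ (lookup (Edges (toℕ t) (σ t)) i) ≡[mod n ] proj₁ (lookup (Edges (toℕ t') (σ t')) j) →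
      proj₂ (lookup (Edges (toℕ t) (σ t)) i) ≡[mod n ] proj₂ (lookup (Edges (toℕ t') (σ t')) j) →
      (t ≡ t') × (toℕ i ≡ toℕ j)

  -- When r is even every step is odd, so S p has the parity of p, and
  -- orienting the faces by the parity of their index is coherent.
  module OddSteps (r-even : + r ≈[ 2 ] + 0) where

    E-odd : ∀ s → + E s ≈[ 2 ] + 1
    E-odd s with s ℕ.≤? N
    ... | yes _ = pow3-odd s
    ... | no  _ = ≈-trans c≈1+r (≈-+ℕ {a = 1} ≈-refl r-even)

    S-parity : ∀ p → + S p ≈[ 2 ] + p
    S-parity zero    = ≈-refl
    S-parity (suc p) = subst (λ x → + (S p + d p) ≈[ 2 ] + x) (ℕP.+-comm p 1)
                             (≈-+ℕ (S-parity p) (E-odd ⌊ p /2⌋))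

    -- Two faces of the same parity traversing a common edge in the same
    -- direction coincide: the edge length fixes the pair of steps, the
    -- parity fixes the step within the pair, and then the face.
    same-direction : ∀ {t t' p q} → t < n → t' < n → p ≤ L1 → q ≤ L1 → parity t ≡ parity t' →
      G t p ≈[ n ] G t' q → G t (suc p) ≈[ n ] G t' (suc q) → t ≡ t' × p ≡ q
    same-direction {t} {t'} {p} {q} t<n t'<n p≤ q≤ same-parity h₁ h₂ = t≡t' , p≡q
      where
      steps : + d p ≈[ n ] + d q
      steps = ≈-cancelˡ {a = G t p} {b = G t' q} (subst₂ _≈[ n ]_ (G-suc t p) (G-suc t' q) h₂) h₁
      halves : ⌊ p /2⌋ ≡ ⌊ q /2⌋
      halves = d-injective p≤ q≤ (≈-small (d<n p) (d<n q) steps)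
      mod2 : + (t + p) ≈[ 2 ] + (t' + q)
      mod2 = ≈-trans (≈-sym (≈-+ℕ ≈-refl (S-parity p)))
                     (≈-trans (≈-weaken 2∣n h₁) (≈-+ℕ ≈-refl (S-parity q)))
      p≡q : p ≡ q
      p≡q = half-parity-injective p q halves
              (≈₂⇒parity (≈-cancelˡℕ {a = t} {b = t'} mod2 (parity⇒≈₂ same-parity)))
      t≡t' : t ≡ t'
      t≡t' = ≈-small t<n t'<n (≈-cancelʳℕ h₁ (≈-reflexive (cong (λ z → + S z) p≡q)))

    coinciding-edges : ∀ {t t' u u'} b b' → t < n → t' < n → u ≤ L1 → u' ≤ L1 →
      parity t ≡ b → parity t' ≡ b' →
      orient b (G t u , G t (suc u)) ≈²[ n ] orient b' (G t' u' , G t' (suc u')) → t ≡ t' × u ≡ u'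
    coinciding-edges true  true  t< t'< u≤ u'≤ pt pt' (h₁ , h₂) =
      same-direction t< t'< u≤ u'≤ (trans pt (sym pt')) h₁ h₂
    coinciding-edges false false t< t'< u≤ u'≤ pt pt' (h₁ , h₂) =
      same-direction t< t'< u≤ u'≤ (trans pt (sym pt')) h₂ h₁
    coinciding-edges {t} {t'} {u} {u'} true  false _ _ _ _ _ _ (h₁ , h₂) =
      ⊥-elim (opposite-directions t t' u u' h₁ h₂)
    coinciding-edges {t} {t'} {u} {u'} false true  _ _ _ _ _ _ (h₁ , h₂) =
      ⊥-elim (opposite-directions t t' u u' h₂ h₁)

    orientation : Fin n → Bool
    orientation t = parity (toℕ t)

    orientation-coherent : Coherent orientation
    orientation-coherent t t' i j h₁ h₂ = FinP.toℕ-injective t≡t' , i≡j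
      where
      b b' : Bool
      b  = orientation t
      b' = orientation t'
      i≤ : toℕ i ≤ L1
      i≤ = index-≤ (toℕ t) b i
      j≤ : toℕ j ≤ L1
      j≤ = index-≤ (toℕ t') b' j
      u u' : ℕ
      u  = slot L1 b (toℕ i)
      u' = slot L1 b' (toℕ j)
      e : lookup (Edges (toℕ t) b) i ≈²[ n ] orient b (G (toℕ t) u , G (toℕ t) (suc u))
      e = edge-spec (toℕ t) b i
      e' : lookup (Edges (toℕ t') b') j ≈²[ n ] orient b' (G (toℕ t') u' , G (toℕ t') (suc u'))
      e' = edge-spec (toℕ t') b' j
      coinciding : toℕ t ≡ toℕ t' × u ≡ u'
      coinciding = coinciding-edges b b' (FinP.toℕ<n t) (FinP.toℕ<n t')
        (slot-≤ b i≤) (slot-≤ b' j≤) refl refl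
        (≈²-trans (≈²-sym e) (≈²-trans (≡mod⇒≈ h₁ , ≡mod⇒≈ h₂) e'))
      t≡t' : toℕ t ≡ toℕ t'
      t≡t' = proj₁ coinciding
      i≡j : toℕ i ≡ toℕ j
      i≡j = slot-injective b i≤ j≤
              (trans (proj₂ coinciding) (cong (λ b → slot L1 b (toℕ j)) (cong parity (sym t≡t'))))

  orientable : r % 2 ≡ 0 → Orientable n δ
  orientable r-even = orientation , orientation-coherent
    where open OddSteps (subst (λ x → + r ≈[ 2 ] + x) r-even (≈-mod 2 r))

  -- A coherent orientation would have to alternate between adjacent faces
  -- and also differ on the faces 0 and c; for odd r, c is even.
  module Incoherence (σ : Fin n → Bool) (coherent : Coherent σ) where

    oriented-edge : Fin n → ℕ → ℤ × ℤ
    oriented-edge t u = orient (σ t) (G (toℕ t) u , G (toℕ t) (suc u))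

    edge-of : ∀ t {u} → u ≤ L1 →
      Σ (Fin (length (Edges (toℕ t) (σ t)))) λ i → lookup (Edges (toℕ t) (σ t)) i ≈²[ n ] oriented-edge t u
    edge-of t u≤ with edge-at (toℕ t) (σ t) u≤
    ... | i , refl = i , edge-spec (toℕ t) (σ t) i

    shared-edge : ∀ (t t' : Fin n) {u u'} → u ≤ L1 → u' ≤ L1 → σ t ≡ σ t' →
      G (toℕ t) u ≡ G (toℕ t') u' → G (toℕ t) (suc u) ≡ G (toℕ t') (suc u') → t ≡ t'
    shared-edge t t' u≤ u'≤ σ≡ g₁ g₂ with edge-of t u≤ | edge-of t' u'≤
    ... | i , e | j , e' = proj₁ (coherent t t' i j (≈⇒≡mod (first common)) (≈⇒≡mod (second common)))
      where
      common : lookup (Edges (toℕ t) (σ t)) i ≈²[ n ] lookup (Edges (toℕ t') (σ t')) j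
      common = ≈²-trans e (≈²-trans (≈²-reflexive (cong₂ orient σ≡ (cong₂ _,_ g₁ g₂))) (≈²-sym e'))

    -- Faces t and t + 1 share the edge from t + 1 to t + 2, so their
    -- orientations alternate.
    adjacent-faces : ∀ (t t' : Fin n) → suc (toℕ t) ≡ toℕ t' → σ t' ≡ not (σ t)
    adjacent-faces t t' t+1≡t' = BoolP.¬-not λ σ≡ →
      ℕP.1+n≢n (trans t+1≡t' (cong toℕ (sym (shared-edge t t' 1≤L1 z≤n (sym σ≡) step₁ step₂))))
      where
      1≤L1 : 1 ≤ L1
      1≤L1 = s≤s z≤n
      step₁ : G (toℕ t) 1 ≡ G (toℕ t') 0
      step₁ = trans (G-unit-step (toℕ t) 0 (E-low z≤n)) (cong (λ z → G z 0) t+1≡t')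
      step₂ : G (toℕ t) 2 ≡ G (toℕ t') 1
      step₂ = trans (G-unit-step (toℕ t) 1 (E-low z≤n)) (cong (λ z → G z 1) t+1≡t')

    0<n : 0 < n
    0<n = ℕP.≤-<-trans z≤n c<n

    face₀ : Fin n
    face₀ = fromℕ< 0<n

    even-faces : ∀ m (t : Fin n) → toℕ t ≡ m → parity m ≡ true → σ t ≡ σ face₀
    even-faces zero          t t≡0 _    = cong σ (FinP.toℕ-injective (trans t≡0 (sym (FinP.toℕ-fromℕ< 0<n))))
    even-faces (suc zero)    t _   ()
    even-faces (suc (suc m)) t t≡m even = begin
      σ t            ≡⟨ adjacent-faces t₁ t (trans (cong suc (FinP.toℕ-fromℕ< m+1<n)) (sym t≡m)) ⟩
      not (σ t₁)     ≡⟨ cong not (adjacent-faces t₂ t₁ (trans (cong suc (FinP.toℕ-fromℕ< m<n))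
                                                               (sym (FinP.toℕ-fromℕ< m+1<n)))) ⟩
      not (not (σ t₂)) ≡⟨ BoolP.not-involutive (σ t₂) ⟩
      σ t₂           ≡⟨ even-faces m t₂ (FinP.toℕ-fromℕ< m<n) even ⟩
      σ face₀        ∎
      where
      open ≡-Reasoning
      m+1<n : suc m < n
      m+1<n = ℕP.<-trans (ℕP.n<1+n (suc m)) (subst (_< n) t≡m (FinP.toℕ<n t))
      m<n : m < n
      m<n = ℕP.<-trans (ℕP.n<1+n m) m+1<n
      t₁ t₂ : Fin n
      t₁ = fromℕ< m+1<n
      t₂ = fromℕ< m<n

    face-c : Fin n
    face-c = fromℕ< c<n

    -- Faces 0 and c share the edge from n - c to n, which is the last edge
    -- of face 0 and the second-last one of face c.
    opposite-faces : σ face₀ ≢ σ face-c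
    opposite-faces σ≡ = ℕP.<-irrefl c≡0 c-positive
      where
      0+ : ∀ x → toℕ face₀ + x ≡ x
      0+ x = cong (_+ x) (FinP.toℕ-fromℕ< 0<n)
      c+ : ∀ x → toℕ face-c + x ≡ c + x
      c+ x = cong (_+ x) (FinP.toℕ-fromℕ< c<n)
      step₁ : G (toℕ face₀) L1 ≡ G (toℕ face-c) (twice (suc N))
      step₁ = cong +_ (trans (0+ (S L1)) (trans S-L1 (trans (ℕP.+-comm X c) (sym (c+ X)))))
      step₂ : G (toℕ face₀) (suc L1) ≡ G (toℕ face-c) L1
      step₂ = cong +_ (trans (0+ (S (suc L1)))
                (trans (cong (λ z → S L1 + z) (trans (d-suc-twice (suc N)) E-top))
                       (trans (ℕP.+-comm (S L1) c) (sym (c+ (S L1))))))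
      c≡0 : 0 ≡ c
      c≡0 = trans (sym (FinP.toℕ-fromℕ< 0<n))
                  (trans (cong toℕ (shared-edge face₀ face-c ℕP.≤-refl (ℕP.n≤1+n _) σ≡ step₁ step₂))
                         (FinP.toℕ-fromℕ< c<n))

  c-even : r % 2 ≡ 1 → parity c ≡ true
  c-even r-odd = ≈₂⇒parity (≈-trans c≈1+r (≈-trans (≈-+ℕ {a = 1} ≈-refl r≈1) (≈-plus-multiple 0 1)))
    where
    r≈1 : + r ≈[ 2 ] + 1
    r≈1 = subst (λ x → + r ≈[ 2 ] + x) r-odd (≈-mod 2 r)

  not-orientable : r % 2 ≡ 1 → ¬ Orientable n δ
  not-orientable r-odd (σ , coherent) =
    opposite-faces (sym (even-faces c face-c (FinP.toℕ-fromℕ< c<n) (c-even r-odd)))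
    where open Incoherence σ coherent

-- With k = N + 2 both directions hold in Polygon N r; the hypothesis 3 ≤ k
-- is only needed to exclude k < 2.
mainTheorem17 : (k r : ℕ) → 3 ≤ k →
    (r % 2 ≡ 0 → Orientable (Dn k r) (Dseq k r)) ×
    (r % 2 ≡ 1 → ¬ Orientable (Dn k r) (Dseq k r))
mainTheorem17 (suc (suc N)) r _ = Polygon.orientable N r , Polygon.not-orientable N r
mainTheorem17 zero       r ()
mainTheorem17 (suc zero) r (s≤s ())
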